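{- Let $k\ge1$, let $(l_1,r_1),\dots,(l_n,r_n)$ be pairs of nonnegative integers, and let $1\le i\le n$. The number of $k$-noncrossing graphs (on $[n]$) with left-right degree sequence $(l_1,r_1),\dots,(l_n,r_n)$ equals the number of $k$-noncrossing graphs (on $[n+1]$) with left-right degree sequence $(l_1,r_1),\dots,(l_{i-1},r_{i-1}),(l_i,0),(0,r_i),(l_{i+1},r_{i+1}),\dots,(l_n,r_n)$. The same holds with "$k$-noncrossing" replaced by "$k$-nonnesting".
   Context: Graphs on $[n]=\{1,\dots,n\}$ may have multiple edges and isolated vertices but no loops. The left (resp. right) degree of a vertex $i$ is the number of edges (counted with multiplicity) joining $i$ to a vertex $j<i$ (resp. $j>i$); the left-right degree sequence is the sequence of pairs (left degree, right degree) of the vertices $1,2,\dots$ in order. A $k$-crossing is a set of $k$ edges $\{i_1,j_1\},\dots,\{i_k,j_k\}$ with $i_1<\cdots<i_k<j_1<\cdots<j_k$; a $k$-nesting is a set of $k$ edges with $i_1<\cdots<i_k<j_k<\cdots<j_1$. A graph is $k$-noncrossing (resp. $k$-nonnesting) if it contains no $k$-crossing (resp. no $k$-nesting). -}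

module Defs where

open import Level using (0ℓ)
open import Data.Nat using (ℕ; _≤_)
open import Data.Fin using (Fin; _<_; _<?_)
open import Data.List using (List; length; lookup; tabulate)
open import Data.Nat.ListAction using (sum)
open import Data.Empty using (⊥)
open import Data.Product using (Σ; _×_; _,_; proj₁)
open import Data.Bool using (if_then_else_)
open import Relation.Nullary using (does)
open import Relation.Binary.PropositionalEquality using (_≡_; refl; sym; trans)
open import Relation.Binary.Bundles using (Setoid)

-- A (multi)graph on the vertex set Fin n (standing for [n], vertex v ↔ toℕ v + 1).
-- G u v is the number of edges joining u and v; only the entries with u < v are
-- meaningful (entries with u ≥ v are ignored: no loops, each edge {u,v} is
-- recorded once at (min, max)).
Graph : ℕ → Set
Graph n = Fin n → Fin n → ℕ

_≈G_ : ∀ {n} → Graph n → Graph n → Set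
_≈G_ {n} G H = ∀ (u v : Fin n) → u < v → G u v ≡ H u v

Σv : ∀ {n} → (Fin n → ℕ) → ℕ
Σv f = sum (tabulate f)

leftDeg : ∀ {n} → Graph n → Fin n → ℕ
leftDeg G v = Σv (λ u → if does (u <? v) then G u v else 0)

rightDeg : ∀ {n} → Graph n → Fin n → ℕ
rightDeg G v = Σv (λ w → if does (v <? w) then G v w else 0)

HasDegSeq : (ds : List (ℕ × ℕ)) → Graph (length ds) → Set
HasDegSeq ds G = ∀ v → (leftDeg G v , rightDeg G v) ≡ lookup ds v

HasCrossing : ∀ {n} → ℕ → Graph n → Set
HasCrossing {n} k G =
  Σ (Fin k → Fin n) λ a → Σ (Fin k → Fin n) λ b →
    (∀ s t → s < t → a s < a t) × (∀ s t → s < t → b s < b t) ×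
    (∀ s t → a s < b t) × (∀ t → 1 ≤ G (a t) (b t))

HasNesting : ∀ {n} → ℕ → Graph n → Set
HasNesting {n} k G =
  Σ (Fin k → Fin n) λ a → Σ (Fin k → Fin n) λ b →
    (∀ s t → s < t → a s < a t) × (∀ s t → s < t → b t < b s) ×
    (∀ s t → a s < b t) × (∀ t → 1 ≤ G (a t) (b t))

NonCrossing : ∀ {n} → ℕ → Graph n → Set
NonCrossing k G = HasCrossing k G → ⊥

NonNesting : ∀ {n} → ℕ → Graph n → Set
NonNesting k G = HasNesting k G → ⊥

-- Two such setoids having a bijection
-- (Function.Bundles.Inverse) is "having the same number of graphs".
GraphsWith : (ds : List (ℕ × ℕ)) → (Graph (length ds) → Set) → Setoid 0ℓ 0ℓ
GraphsWith ds P = record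
  { Carrier = Σ (Graph (length ds)) (λ G → HasDegSeq ds G × P G)
  ; _≈_ = λ x y → proj₁ x ≈G proj₁ y
  ; isEquivalence = record
    { refl = λ u v _ → refl
    ; sym = λ p u v q → sym (p u v q)
    ; trans = λ p q u v r → trans (p u v r) (q u v r)
    }
  }

-- Split vertex p into two adjacent vertices p⁻ < p⁺, giving p⁻ the edges to the left
-- of p and p⁺ those to its right; gluing them back is the inverse map.  An edge {u, v}
-- with u < v keeps its endpoints, except that p as right end becomes p⁻ and p as left
-- end becomes p⁺.  Collapsing p⁻ and p⁺ identifies only the pair p⁻ < p⁺, and no edge
-- starts at p⁻ or ends at p⁺, so the order relations among endpoints of edges, hence
-- k-crossings and k-nestings, are the same on both sides.
module Submission where

open import Level using (0ℓ)
open import Data.Bool using (if_then_else_)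
open import Data.Bool.Properties using (if-eta)
open import Data.Fin as Fin using (Fin; zero; suc; inject₁; punchIn; pinch; cast; _<_; _<?_)
open import Data.Fin.Properties
  using ( _≟_; suc-injective; punchInᵢ≢i; punchIn-injective; punchIn-cancel-≤; pinch-mono-≤
        ; cast-is-id)
open import Data.List using (List; []; _∷_; _++_; length; lookup)
open import Data.List.Properties using (tabulate-cong)
open import Data.Nat using (ℕ; zero; suc; _+_; _≤_; z<s; s<s)
import Data.Nat.Properties as ℕ
open import Algebra.Properties.CommutativeSemigroup ℕ.+-commutativeSemigroup using (x∙yz≈y∙xz)
open import Data.Nat.ListAction using (sum)
open import Data.Product using (Σ; _×_; _,_; proj₁; proj₂)
open import Data.Sum using (_⊎_; inj₁; inj₂; [_,_]′) renaming (map to ⊎-map)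
open import Data.Empty using (⊥-elim)
open import Function using (_∘_; _$_; id)
open import Function.Bundles using (Inverse; _⇔_; mk⇔)
open import Function.Construct.Composition using (inverse)
open import Relation.Nullary using (Dec; yes; no; does; contradiction)
open import Relation.Nullary.Decidable using (dec-true; does-⇔)
open import Relation.Binary.Bundles using (Setoid)
open import Relation.Binary.PropositionalEquality
open import Defs

punchIn-mono-< : ∀ {n} (i : Fin (suc n)) {j k : Fin n} → j < k → punchIn i j < punchIn i k
punchIn-mono-< i j<k = ℕ.≰⇒> (ℕ.<⇒≱ j<k ∘ punchIn-cancel-≤ i _ _)

punchIn-inject₁<punchIn-suc : ∀ {n} (i : Fin n) {j k : Fin n} →
                              j < k → punchIn (inject₁ i) j < punchIn (suc i) k
punchIn-inject₁<punchIn-suc zero    {_}     {suc _} j<k       = s<s j<k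
punchIn-inject₁<punchIn-suc (suc i) {zero}  {suc _} _         = z<s
punchIn-inject₁<punchIn-suc (suc i) {suc _} {suc _} (s<s j<k) =
  s<s (punchIn-inject₁<punchIn-suc i j<k)

pinch-punchIn-inject₁ : ∀ {n} (i j : Fin n) → pinch i (punchIn (inject₁ i) j) ≡ j
pinch-punchIn-inject₁ zero    j       = refl
pinch-punchIn-inject₁ (suc i) zero    = refl
pinch-punchIn-inject₁ (suc i) (suc j) = cong suc (pinch-punchIn-inject₁ i j)

pinch-punchIn-suc : ∀ {n} (i j : Fin n) → pinch i (punchIn (suc i) j) ≡ j
pinch-punchIn-suc zero    zero    = refl
pinch-punchIn-suc zero    (suc j) = refl
pinch-punchIn-suc (suc i) zero    = refl
pinch-punchIn-suc (suc i) (suc j) = cong suc (pinch-punchIn-suc i j)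

punchIn-inject₁-pinch : ∀ {n} (i : Fin n) x →
                        x ≢ inject₁ i → punchIn (inject₁ i) (pinch i x) ≡ x
punchIn-inject₁-pinch zero    zero    x≢i = contradiction refl x≢i
punchIn-inject₁-pinch zero    (suc x) _   = refl
punchIn-inject₁-pinch (suc i) zero    _   = refl
punchIn-inject₁-pinch (suc i) (suc x) x≢i =
  cong suc (punchIn-inject₁-pinch i x (x≢i ∘ cong suc))

punchIn-suc-pinch : ∀ {n} (i : Fin n) x → x ≢ suc i → punchIn (suc i) (pinch i x) ≡ x
punchIn-suc-pinch zero    zero          _   = refl
punchIn-suc-pinch zero    (suc zero)    x≢i = contradiction refl x≢i
punchIn-suc-pinch zero    (suc (suc x)) _   = refl
punchIn-suc-pinch (suc i) zero          _   = refl
punchIn-suc-pinch (suc i) (suc x)       x≢i = cong suc (punchIn-suc-pinch i x (x≢i ∘ cong suc))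

inject₁≢suc : ∀ {n} (i : Fin n) → inject₁ i ≢ suc i
inject₁≢suc zero    ()
inject₁≢suc (suc i) = inject₁≢suc i ∘ suc-injective

pinch-inject₁-self : ∀ {n} (i : Fin n) → pinch i (inject₁ i) ≡ i
pinch-inject₁-self zero    = refl
pinch-inject₁-self (suc i) = cong suc (pinch-inject₁-self i)

pinch-suc-self : ∀ {n} (i : Fin n) → pinch i (suc i) ≡ i
pinch-suc-self zero    = refl
pinch-suc-self (suc i) = cong suc (pinch-suc-self i)

punchIn-suc-self : ∀ {n} (i : Fin n) → punchIn (suc i) i ≡ inject₁ i
punchIn-suc-self zero    = refl
punchIn-suc-self (suc i) = cong suc (punchIn-suc-self i)

punchIn-inject₁-self : ∀ {n} (i : Fin n) → punchIn (inject₁ i) i ≡ suc i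
punchIn-inject₁-self zero    = refl
punchIn-inject₁-self (suc i) = cong suc (punchIn-inject₁-self i)

punchIn-suc≡inject₁⇒≡ : ∀ {n} (i j : Fin n) → punchIn (suc i) j ≡ inject₁ i → j ≡ i
punchIn-suc≡inject₁⇒≡ i j eq =
  punchIn-injective (suc i) j i (trans eq (sym (punchIn-suc-self i)))

punchIn-inject₁≡suc⇒≡ : ∀ {n} (i j : Fin n) → punchIn (inject₁ i) j ≡ suc i → j ≡ i
punchIn-inject₁≡suc⇒≡ i j eq =
  punchIn-injective (inject₁ i) j i (trans eq (sym (punchIn-inject₁-self i)))

pinch-mono-< : ∀ {n} (i : Fin n) {x y} →
               x ≢ inject₁ i ⊎ y ≢ suc i → x < y → pinch i x < pinch i y
pinch-mono-< _       {_}     {zero}        _     ()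
pinch-mono-< zero    {zero}  {suc zero}    avoid _         = ⊥-elim ([ _$ refl , _$ refl ]′ avoid)
pinch-mono-< zero    {zero}  {suc (suc _)} _     _         = z<s
pinch-mono-< zero    {suc _} {suc _}       _     (s<s x<y) = x<y
pinch-mono-< (suc i) {zero}  {suc _}       _     _         = z<s
pinch-mono-< (suc i) {suc _} {suc _}       avoid (s<s x<y) =
  s<s (pinch-mono-< i (⊎-map (_∘ cong suc) (_∘ cong suc) avoid) x<y)

punchIn-inject₁<⇔<pinch : ∀ {n} (i j : Fin n) x → punchIn (inject₁ i) j < x ⇔ j < pinch i x
punchIn-inject₁<⇔<pinch i j x = mk⇔
  (λ lt → subst (_< pinch i x) (pinch-punchIn-inject₁ i j)
                (pinch-mono-< i (inj₁ (punchInᵢ≢i _ j)) lt))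
  (λ lt → ℕ.≰⇒> λ le → ℕ.<⇒≱ lt
            (subst (pinch i x Fin.≤_) (pinch-punchIn-inject₁ i j) (pinch-mono-≤ i le)))

<punchIn-suc⇔pinch< : ∀ {n} (i j : Fin n) x → x < punchIn (suc i) j ⇔ pinch i x < j
<punchIn-suc⇔pinch< i j x = mk⇔
  (λ lt → subst (pinch i x <_) (pinch-punchIn-suc i j)
                (pinch-mono-< i (inj₂ (punchInᵢ≢i _ j)) lt))
  (λ lt → ℕ.≰⇒> λ le → ℕ.<⇒≱ lt
            (subst (Fin._≤ pinch i x) (pinch-punchIn-suc i j) (pinch-mono-≤ i le)))

Σv-cong : ∀ {n} {f g : Fin n → ℕ} → (∀ x → f x ≡ g x) → Σv f ≡ Σv g
Σv-cong f≗g = cong sum (tabulate-cong f≗g)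

Σv-zero : ∀ {n} {f : Fin n → ℕ} → (∀ x → f x ≡ 0) → Σv f ≡ 0
Σv-zero {zero}  _   = refl
Σv-zero {suc n} f≗0 = cong₂ _+_ (f≗0 zero) (Σv-zero (f≗0 ∘ suc))

Σv≡0⇒≡0 : ∀ {n} (f : Fin n → ℕ) → Σv f ≡ 0 → ∀ x → f x ≡ 0
Σv≡0⇒≡0 f Σf≡0 zero    = ℕ.m+n≡0⇒m≡0 (f zero) Σf≡0
Σv≡0⇒≡0 f Σf≡0 (suc x) = Σv≡0⇒≡0 (f ∘ suc) (ℕ.m+n≡0⇒n≡0 (f zero) Σf≡0) x

Σv-punchIn : ∀ {n} (i : Fin (suc n)) (f : Fin (suc n) → ℕ) → Σv f ≡ f i + Σv (f ∘ punchIn i)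
Σv-punchIn         zero    f = refl
Σv-punchIn {suc n} (suc i) f =
  trans (cong (f zero +_) (Σv-punchIn i (f ∘ suc))) (x∙yz≈y∙xz (f zero) (f (suc i)) _)

if-then-0 : ∀ b {m : ℕ} → m ≡ 0 → (if b then m else 0) ≡ 0
if-then-0 b m≡0 = trans (cong (λ m → if b then m else 0) m≡0) (if-eta b)

if-does-cong : ∀ {A : Set} (a? : Dec A) {m n : ℕ} → (A → m ≡ n) →
               (if does a? then m else 0) ≡ (if does a? then n else 0)
if-does-cong (yes a) m≡n = m≡n a
if-does-cong (no _)  _   = refl

≈G-trans : ∀ {m} {G H K : Graph m} → G ≈G H → H ≈G K → G ≈G K
≈G-trans G≈H H≈K u v u<v = trans (G≈H u v u<v) (H≈K u v u<v)

leftDeg-cong : ∀ {m} {G H : Graph m} → G ≈G H → ∀ v → leftDeg G v ≡ leftDeg H v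
leftDeg-cong G≈H v = Σv-cong λ u → if-does-cong (u <? v) (G≈H u v)

rightDeg-cong : ∀ {m} {G H : Graph m} → G ≈G H → ∀ v → rightDeg G v ≡ rightDeg H v
rightDeg-cong G≈H v = Σv-cong λ w → if-does-cong (v <? w) (G≈H v w)

leftDeg≡0⇒no-left-edge : ∀ {m} (G : Graph m) {u v} → leftDeg G v ≡ 0 → u < v → G u v ≡ 0
leftDeg≡0⇒no-left-edge G {u} {v} deg≡0 u<v =
  trans (sym (cong (λ b → if b then G u v else 0) (dec-true (u <? v) u<v)))
        (Σv≡0⇒≡0 _ deg≡0 u)

rightDeg≡0⇒no-right-edge : ∀ {m} (G : Graph m) {v w} → rightDeg G v ≡ 0 → v < w → G v w ≡ 0
rightDeg≡0⇒no-right-edge G {v} {w} deg≡0 v<w =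
  trans (sym (cong (λ b → if b then G v w else 0) (dec-true (v <? w) v<w)))
        (Σv≡0⇒≡0 _ deg≡0 w)

HasDegrees : ∀ {m} → (Fin m → ℕ × ℕ) → Graph m → Set
HasDegrees d G = ∀ v → (leftDeg G v , rightDeg G v) ≡ d v

-- GraphsWith ds P is definitionally GraphsWithDegrees (length ds) (lookup ds) P.
GraphsWithDegrees : (m : ℕ) → (Fin m → ℕ × ℕ) → (Graph m → Set) → Setoid 0ℓ 0ℓ
GraphsWithDegrees m d P = record
  { Carrier = Σ (Graph m) (λ G → HasDegrees d G × P G)
  ; _≈_ = λ x y → proj₁ x ≈G proj₁ y
  ; isEquivalence = record
    { refl = λ u v _ → refl
    ; sym = λ p u v q → sym (p u v q)
    ; trans = λ p q u v r → trans (p u v r) (q u v r)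
    }
  }

GraphsWithDegrees-cast : ∀ {m m'} (e : m ≡ m') (d : Fin m' → ℕ × ℕ)
                         (Q : ∀ {j} → Graph j → Set) →
                         Inverse (GraphsWithDegrees m (d ∘ cast e) Q) (GraphsWithDegrees m' d Q)
GraphsWithDegrees-cast refl d Q = record
  { to        = λ { (G , degG , q) → G , (λ v → trans (degG v) (cong d (cast-is-id refl v))) , q }
  ; from      = λ { (G , degG , q) →
                    G , (λ v → trans (degG v) (cong d (sym (cast-is-id refl v)))) , q }
  ; to-cong   = id
  ; from-cong = id
  ; inverse   = id , id
  }

record IsSplitAt {n} (p : Fin n) (d : Fin n → ℕ × ℕ) (d' : Fin (suc n) → ℕ × ℕ) : Set where
  field
    at-inject₁ : d' (inject₁ p) ≡ (proj₁ (d p) , 0)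
    at-suc     : d' (suc p) ≡ (0 , proj₂ (d p))
    elsewhere  : ∀ x → x ≢ inject₁ p → x ≢ suc p → d' x ≡ d (pinch p x)

module SplitVertex {n : ℕ} (p : Fin n) where

  p⁻ p⁺ : Fin (suc n)
  p⁻ = inject₁ p
  p⁺ = suc p

  split : Graph n → Graph (suc n)
  split G x y with x ≟ p⁻ | y ≟ p⁺
  ... | no _ | no _ = G (pinch p x) (pinch p y)
  ... | _    | _    = 0

  merge : Graph (suc n) → Graph n
  merge H u v = H (punchIn p⁻ u) (punchIn p⁺ v)

  split-p⁻ : ∀ G y → split G p⁻ y ≡ 0
  split-p⁻ G y with p⁻ ≟ p⁻
  ... | yes _     = refl
  ... | no p⁻≢p⁻ = contradiction refl p⁻≢p⁻

  split-p⁺ : ∀ G x → split G x p⁺ ≡ 0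
  split-p⁺ G x with x ≟ p⁻ | p⁺ ≟ p⁺
  ... | yes _ | _         = refl
  ... | no _  | yes _     = refl
  ... | no _  | no p⁺≢p⁺ = contradiction refl p⁺≢p⁺

  split-inner : ∀ G {x y} → x ≢ p⁻ → y ≢ p⁺ → split G x y ≡ G (pinch p x) (pinch p y)
  split-inner G {x} {y} x≢p⁻ y≢p⁺ with x ≟ p⁻ | y ≟ p⁺
  ... | yes x≡p⁻ | _         = contradiction x≡p⁻ x≢p⁻
  ... | no _     | yes y≡p⁺ = contradiction y≡p⁺ y≢p⁺
  ... | no _     | no _      = refl

  split-edge⇒≢p⁻ : ∀ G x y → 1 ≤ split G x y → x ≢ p⁻
  split-edge⇒≢p⁻ G _ y e refl = ℕ.1+n≰n (subst (1 ≤_) (split-p⁻ G y) e)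

  split-edge⇒≢p⁺ : ∀ G x y → 1 ≤ split G x y → y ≢ p⁺
  split-edge⇒≢p⁺ G x _ e refl = ℕ.1+n≰n (subst (1 ≤_) (split-p⁺ G x) e)

  split-edge⇒edge : ∀ G x y → 1 ≤ split G x y → 1 ≤ G (pinch p x) (pinch p y)
  split-edge⇒edge G x y e =
    subst (1 ≤_) (split-inner G (split-edge⇒≢p⁻ G x y e) (split-edge⇒≢p⁺ G x y e)) e

  split-cong : ∀ {G G'} → G ≈G G' → split G ≈G split G'
  split-cong {G} {G'} G≈G' x y x<y with x ≟ p⁻ | y ≟ p⁺
  ... | no x≢p⁻ | no _  = G≈G' (pinch p x) (pinch p y) (pinch-mono-< p (inj₁ x≢p⁻) x<y)
  ... | yes _   | _     = refl
  ... | no _    | yes _ = refl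

  merge-cong : ∀ {H H'} → H ≈G H' → merge H ≈G merge H'
  merge-cong H≈H' u v u<v = H≈H' _ _ (punchIn-inject₁<punchIn-suc p u<v)

  merge-split : ∀ G → merge (split G) ≈G G
  merge-split G u v _ = trans (split-inner G (punchInᵢ≢i p⁻ u) (punchInᵢ≢i p⁺ v))
                              (cong₂ G (pinch-punchIn-inject₁ p u) (pinch-punchIn-suc p v))

  split-merge : ∀ H → rightDeg H p⁻ ≡ 0 → leftDeg H p⁺ ≡ 0 → split (merge H) ≈G H
  split-merge H right₀ left₀ x y x<y with x ≟ p⁻ | y ≟ p⁺
  ... | yes refl | _        = sym (rightDeg≡0⇒no-right-edge H right₀ x<y)
  ... | no _     | yes refl = sym (leftDeg≡0⇒no-left-edge H left₀ x<y)
  ... | no x≢p⁻  | no y≢p⁺  =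
    cong₂ H (punchIn-inject₁-pinch p x x≢p⁻) (punchIn-suc-pinch p y y≢p⁺)

  leftDeg-split-p⁺ : ∀ G → leftDeg (split G) p⁺ ≡ 0
  leftDeg-split-p⁺ G = Σv-zero λ u → if-then-0 (does (u <? p⁺)) (split-p⁺ G u)

  rightDeg-split-p⁻ : ∀ G → rightDeg (split G) p⁻ ≡ 0
  rightDeg-split-p⁻ G = Σv-zero λ w → if-then-0 (does (p⁻ <? w)) (split-p⁻ G w)

  leftDeg-split : ∀ G {x} → x ≢ p⁺ → leftDeg (split G) x ≡ leftDeg G (pinch p x)
  leftDeg-split G {x} x≢p⁺ =
    trans (Σv-punchIn p⁻ (λ u → if does (u <? x) then split G u x else 0))
          (cong₂ _+_ (if-then-0 (does (p⁻ <? x)) (split-p⁻ G x)) (Σv-cong term))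
    where
    term : ∀ z → (if does (punchIn p⁻ z <? x) then split G (punchIn p⁻ z) x else 0)
               ≡ (if does (z <? pinch p x) then G z (pinch p x) else 0)
    term z = cong₂ (λ b m → if b then m else 0)
      (does-⇔ (punchIn-inject₁<⇔<pinch p z x) (punchIn p⁻ z <? x) (z <? pinch p x))
      (trans (split-inner G (punchInᵢ≢i p⁻ z) x≢p⁺)
             (cong (λ u → G u (pinch p x)) (pinch-punchIn-inject₁ p z)))

  rightDeg-split : ∀ G {x} → x ≢ p⁻ → rightDeg (split G) x ≡ rightDeg G (pinch p x)
  rightDeg-split G {x} x≢p⁻ =
    trans (Σv-punchIn p⁺ (λ w → if does (x <? w) then split G x w else 0))
          (cong₂ _+_ (if-then-0 (does (x <? p⁺)) (split-p⁺ G x)) (Σv-cong term))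
    where
    term : ∀ z → (if does (x <? punchIn p⁺ z) then split G x (punchIn p⁺ z) else 0)
               ≡ (if does (pinch p x <? z) then G (pinch p x) z else 0)
    term z = cong₂ (λ b m → if b then m else 0)
      (does-⇔ (<punchIn-suc⇔pinch< p z x) (x <? punchIn p⁺ z) (pinch p x <? z))
      (trans (split-inner G x≢p⁻ (punchInᵢ≢i p⁺ z))
             (cong (G (pinch p x)) (pinch-punchIn-suc p z)))

  leftDeg-merge : ∀ H → rightDeg H p⁻ ≡ 0 → leftDeg H p⁺ ≡ 0 →
                  ∀ v → leftDeg (merge H) v ≡ leftDeg H (punchIn p⁺ v)
  leftDeg-merge H right₀ left₀ v = begin
    leftDeg (merge H) v
      ≡⟨ cong (leftDeg (merge H)) (pinch-punchIn-suc p v) ⟨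
    leftDeg (merge H) (pinch p (punchIn p⁺ v))
      ≡⟨ leftDeg-split (merge H) (punchInᵢ≢i p⁺ v) ⟨
    leftDeg (split (merge H)) (punchIn p⁺ v)
      ≡⟨ leftDeg-cong (split-merge H right₀ left₀) _ ⟩
    leftDeg H (punchIn p⁺ v)
      ∎
    where open ≡-Reasoning

  rightDeg-merge : ∀ H → rightDeg H p⁻ ≡ 0 → leftDeg H p⁺ ≡ 0 →
                   ∀ v → rightDeg (merge H) v ≡ rightDeg H (punchIn p⁻ v)
  rightDeg-merge H right₀ left₀ v = begin
    rightDeg (merge H) v
      ≡⟨ cong (rightDeg (merge H)) (pinch-punchIn-inject₁ p v) ⟨
    rightDeg (merge H) (pinch p (punchIn p⁻ v))
      ≡⟨ rightDeg-split (merge H) (punchInᵢ≢i p⁻ v) ⟨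
    rightDeg (split (merge H)) (punchIn p⁻ v)
      ≡⟨ rightDeg-cong (split-merge H right₀ left₀) _ ⟩
    rightDeg H (punchIn p⁻ v)
      ∎
    where open ≡-Reasoning

  split-nonCrossing : ∀ k G → NonCrossing k G → NonCrossing k (split G)
  split-nonCrossing k G noCross (a , b , a↑ , b↑ , a<b , edge) = noCross
    ( pinch p ∘ a , pinch p ∘ b
    , (λ s t s<t → pinch-mono-< p (inj₁ (a≢p⁻ s)) (a↑ s t s<t))
    , (λ s t s<t → pinch-mono-< p (inj₂ (b≢p⁺ t)) (b↑ s t s<t))
    , (λ s t → pinch-mono-< p (inj₁ (a≢p⁻ s)) (a<b s t))
    , (λ t → split-edge⇒edge G (a t) (b t) (edge t)) )
    where
    a≢p⁻ : ∀ t → a t ≢ p⁻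
    a≢p⁻ t = split-edge⇒≢p⁻ G (a t) (b t) (edge t)
    b≢p⁺ : ∀ t → b t ≢ p⁺
    b≢p⁺ t = split-edge⇒≢p⁺ G (a t) (b t) (edge t)

  split-nonNesting : ∀ k G → NonNesting k G → NonNesting k (split G)
  split-nonNesting k G noNest (a , b , a↑ , b↓ , a<b , edge) = noNest
    ( pinch p ∘ a , pinch p ∘ b
    , (λ s t s<t → pinch-mono-< p (inj₁ (a≢p⁻ s)) (a↑ s t s<t))
    , (λ s t s<t → pinch-mono-< p (inj₂ (b≢p⁺ s)) (b↓ s t s<t))
    , (λ s t → pinch-mono-< p (inj₁ (a≢p⁻ s)) (a<b s t))
    , (λ t → split-edge⇒edge G (a t) (b t) (edge t)) )
    where
    a≢p⁻ : ∀ t → a t ≢ p⁻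
    a≢p⁻ t = split-edge⇒≢p⁻ G (a t) (b t) (edge t)
    b≢p⁺ : ∀ t → b t ≢ p⁺
    b≢p⁺ t = split-edge⇒≢p⁺ G (a t) (b t) (edge t)

  merge-nonCrossing : ∀ k H → NonCrossing k H → NonCrossing k (merge H)
  merge-nonCrossing k _ noCross (a , b , a↑ , b↑ , a<b , edge) = noCross
    ( punchIn p⁻ ∘ a , punchIn p⁺ ∘ b
    , (λ s t s<t → punchIn-mono-< p⁻ (a↑ s t s<t))
    , (λ s t s<t → punchIn-mono-< p⁺ (b↑ s t s<t))
    , (λ s t → punchIn-inject₁<punchIn-suc p (a<b s t))
    , edge )

  merge-nonNesting : ∀ k H → NonNesting k H → NonNesting k (merge H)
  merge-nonNesting k _ noNest (a , b , a↑ , b↓ , a<b , edge) = noNest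
    ( punchIn p⁻ ∘ a , punchIn p⁺ ∘ b
    , (λ s t s<t → punchIn-mono-< p⁻ (a↑ s t s<t))
    , (λ s t s<t → punchIn-mono-< p⁺ (b↓ s t s<t))
    , (λ s t → punchIn-inject₁<punchIn-suc p (a<b s t))
    , edge )

  module _ {d : Fin n → ℕ × ℕ} {d' : Fin (suc n) → ℕ × ℕ} (d'-split : IsSplitAt p d d') where
    open IsSplitAt d'-split

    rightDeg-p⁻≡0 : ∀ H → HasDegrees d' H → rightDeg H p⁻ ≡ 0
    rightDeg-p⁻≡0 _ degH = cong proj₂ (trans (degH p⁻) at-inject₁)

    leftDeg-p⁺≡0 : ∀ H → HasDegrees d' H → leftDeg H p⁺ ≡ 0
    leftDeg-p⁺≡0 _ degH = cong proj₁ (trans (degH p⁺) at-suc)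

    proj₁-d'-punchIn-p⁺ : ∀ v → proj₁ (d' (punchIn p⁺ v)) ≡ proj₁ (d v)
    proj₁-d'-punchIn-p⁺ v with v ≟ p
    ... | yes refl = cong proj₁ (trans (cong d' (punchIn-suc-self p)) at-inject₁)
    ... | no v≢p   = cong proj₁ (trans
          (elsewhere _ (v≢p ∘ punchIn-suc≡inject₁⇒≡ p v) (punchInᵢ≢i p⁺ v))
          (cong d (pinch-punchIn-suc p v)))

    proj₂-d'-punchIn-p⁻ : ∀ v → proj₂ (d' (punchIn p⁻ v)) ≡ proj₂ (d v)
    proj₂-d'-punchIn-p⁻ v with v ≟ p
    ... | yes refl = cong proj₂ (trans (cong d' (punchIn-inject₁-self p)) at-suc)
    ... | no v≢p   = cong proj₂ (trans
          (elsewhere _ (punchInᵢ≢i p⁻ v) (v≢p ∘ punchIn-inject₁≡suc⇒≡ p v))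
          (cong d (pinch-punchIn-inject₁ p v)))

    split-hasDegrees : ∀ G → HasDegrees d G → HasDegrees d' (split G)
    split-hasDegrees G degG x = atVertex x (x ≟ p⁻) (x ≟ p⁺)
      where
      open ≡-Reasoning
      atVertex : ∀ x → Dec (x ≡ p⁻) → Dec (x ≡ p⁺) →
                 (leftDeg (split G) x , rightDeg (split G) x) ≡ d' x
      atVertex _ (yes refl) _ = begin
        (leftDeg (split G) p⁻ , rightDeg (split G) p⁻)
          ≡⟨ cong₂ _,_ (leftDeg-split G (inject₁≢suc p)) (rightDeg-split-p⁻ G) ⟩
        (leftDeg G (pinch p p⁻) , 0)   ≡⟨ cong (λ v → leftDeg G v , 0) (pinch-inject₁-self p) ⟩
        (leftDeg G p , 0)              ≡⟨ cong (λ e → proj₁ e , 0) (degG p) ⟩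
        (proj₁ (d p) , 0)              ≡⟨ at-inject₁ ⟨
        d' p⁻                          ∎
      atVertex _ (no _) (yes refl) = begin
        (leftDeg (split G) p⁺ , rightDeg (split G) p⁺)
          ≡⟨ cong₂ _,_ (leftDeg-split-p⁺ G) (rightDeg-split G (inject₁≢suc p ∘ sym)) ⟩
        (0 , rightDeg G (pinch p p⁺))  ≡⟨ cong (λ v → 0 , rightDeg G v) (pinch-suc-self p) ⟩
        (0 , rightDeg G p)             ≡⟨ cong (λ e → 0 , proj₂ e) (degG p) ⟩
        (0 , proj₂ (d p))              ≡⟨ at-suc ⟨
        d' p⁺                          ∎
      atVertex x (no x≢p⁻) (no x≢p⁺) = begin
        (leftDeg (split G) x , rightDeg (split G) x)
          ≡⟨ cong₂ _,_ (leftDeg-split G x≢p⁺) (rightDeg-split G x≢p⁻) ⟩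
        (leftDeg G (pinch p x) , rightDeg G (pinch p x))  ≡⟨ degG (pinch p x) ⟩
        d (pinch p x)                                     ≡⟨ elsewhere x x≢p⁻ x≢p⁺ ⟨
        d' x                                              ∎

    merge-hasDegrees : ∀ H → HasDegrees d' H → HasDegrees d (merge H)
    merge-hasDegrees H degH v = cong₂ _,_
      (trans (leftDeg-merge H right₀ left₀ v)
             (trans (cong proj₁ (degH (punchIn p⁺ v))) (proj₁-d'-punchIn-p⁺ v)))
      (trans (rightDeg-merge H right₀ left₀ v)
             (trans (cong proj₂ (degH (punchIn p⁻ v))) (proj₂-d'-punchIn-p⁻ v)))
      where
      right₀ : rightDeg H p⁻ ≡ 0
      right₀ = rightDeg-p⁻≡0 H degH
      left₀ : leftDeg H p⁺ ≡ 0
      left₀ = leftDeg-p⁺≡0 H degH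

    split-inverse : (Q : Graph n → Set) (Q' : Graph (suc n) → Set) →
                    (∀ G → Q G → Q' (split G)) → (∀ H → Q' H → Q (merge H)) →
                    Inverse (GraphsWithDegrees n d Q) (GraphsWithDegrees (suc n) d' Q')
    split-inverse Q Q' split-Q merge-Q = record
      { to        = λ { (G , degG , q) → split G , split-hasDegrees G degG , split-Q G q }
      ; from      = λ { (H , degH , q) → merge H , merge-hasDegrees H degH , merge-Q H q }
      ; to-cong   = split-cong
      ; from-cong = merge-cong
      ; inverse   = (λ { {H , degH , _} H'≈ → ≈G-trans (split-cong H'≈)
                           (split-merge H (rightDeg-p⁻≡0 H degH) (leftDeg-p⁺≡0 H degH)) })
                  , (λ { {G , _} G'≈ → ≈G-trans (merge-cong G'≈) (merge-split G) })
      }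

splitPoint : ∀ {A : Set} (pre : List A) {x : A} {post : List A} → Fin (length (pre ++ x ∷ post))
splitPoint []        = zero
splitPoint (_ ∷ pre) = suc (splitPoint pre)

length-split : ∀ {A : Set} (pre : List A) {x y z : A} {post : List A} →
               suc (length (pre ++ x ∷ post)) ≡ length (pre ++ y ∷ z ∷ post)
length-split []        = refl
length-split (_ ∷ pre) = cong suc (length-split pre)

module SplitList (l r : ℕ) (post : List (ℕ × ℕ)) where

  degrees : (pre : List (ℕ × ℕ)) → Fin (length (pre ++ (l , r) ∷ post)) → ℕ × ℕ
  degrees pre = lookup (pre ++ (l , r) ∷ post)

  degrees' : (pre : List (ℕ × ℕ)) → Fin (suc (length (pre ++ (l , r) ∷ post))) → ℕ × ℕ
  degrees' pre = lookup (pre ++ (l , 0) ∷ (0 , r) ∷ post) ∘ cast (length-split pre)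

  degrees'-isSplitAt : ∀ pre → IsSplitAt (splitPoint pre) (degrees pre) (degrees' pre)
  degrees'-isSplitAt pre = record
    { at-inject₁ = at-inject₁ pre ; at-suc = at-suc pre ; elsewhere = elsewhere pre }
    where
    at-inject₁ : ∀ pre → degrees' pre (inject₁ (splitPoint pre))
                         ≡ (proj₁ (degrees pre (splitPoint pre)) , 0)
    at-inject₁ []        = refl
    at-inject₁ (_ ∷ pre) = at-inject₁ pre

    at-suc : ∀ pre → degrees' pre (suc (splitPoint pre))
                     ≡ (0 , proj₂ (degrees pre (splitPoint pre)))
    at-suc []        = refl
    at-suc (_ ∷ pre) = at-suc pre

    elsewhere : ∀ pre x → x ≢ inject₁ (splitPoint pre) → x ≢ suc (splitPoint pre) →
                degrees' pre x ≡ degrees pre (pinch (splitPoint pre) x)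
    elsewhere []        zero          x≢p⁻ _    = contradiction refl x≢p⁻
    elsewhere []        (suc zero)    _    x≢p⁺ = contradiction refl x≢p⁺
    elsewhere []        (suc (suc x)) _    _    = cong (lookup post) (cast-is-id _ x)
    elsewhere (_ ∷ pre) zero          _    _    = refl
    elsewhere (_ ∷ pre) (suc x)       x≢p⁻ x≢p⁺ =
      elsewhere pre x (x≢p⁻ ∘ cong suc) (x≢p⁺ ∘ cong suc)

  splitEntry-inverse : ∀ pre (Q : ∀ {m} → Graph m → Set) →
    (∀ {m} (p : Fin m) G → Q G → Q (SplitVertex.split p G)) →
    (∀ {m} (p : Fin m) H → Q H → Q (SplitVertex.merge p H)) →
    Inverse (GraphsWith (pre ++ (l , r) ∷ post) Q)
            (GraphsWith (pre ++ (l , 0) ∷ (0 , r) ∷ post) Q)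
  splitEntry-inverse pre Q split-Q merge-Q = inverse
    (SplitVertex.split-inverse (splitPoint pre) (degrees'-isSplitAt pre) Q Q
      (split-Q (splitPoint pre)) (merge-Q (splitPoint pre)))
    (GraphsWithDegrees-cast (length-split pre) (lookup (pre ++ (l , 0) ∷ (0 , r) ∷ post)) Q)

lemma3p4 : (k : ℕ) → 1 ≤ k → (pre post : List (ℕ × ℕ)) → (l r : ℕ) →
    Inverse (GraphsWith (pre ++ (l , r) ∷ post) (NonCrossing k))
            (GraphsWith (pre ++ (l , 0) ∷ (0 , r) ∷ post) (NonCrossing k))
    × Inverse (GraphsWith (pre ++ (l , r) ∷ post) (NonNesting k))
              (GraphsWith (pre ++ (l , 0) ∷ (0 , r) ∷ post) (NonNesting k))
lemma3p4 k _ pre post l r =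
    splitEntry-inverse pre (NonCrossing k)
      (λ p → SplitVertex.split-nonCrossing p k) (λ p → SplitVertex.merge-nonCrossing p k)
  , splitEntry-inverse pre (NonNesting k)
      (λ p → SplitVertex.split-nonNesting p k) (λ p → SplitVertex.merge-nonNesting p k)
  where open SplitList l r post
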